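{- If there exists an $(r-1,k)_q$-evasive subspace of $\mathbb{F}_q$-dimension $d$ in $V(r,q^n)$, then for every positive integer $s$ with $d-k\le s\le n$ there exists in $V(r+1,q^n)$ an $(r,k+s)_q$-evasive subspace of $\mathbb{F}_q$-dimension $d+s$.
   Context: $V(m,q^n)$ denotes an $m$-dimensional vector space over $\mathbb{F}_{q^n}$, viewed also as an $mn$-dimensional vector space over $\mathbb{F}_q$. For positive integers $h,k$, an $\mathbb{F}_q$-subspace $U$ of $V(m,q^n)$ is called $(h,k)_q$-evasive if $\langle U\rangle_{\mathbb{F}_{q^n}}$ has $\mathbb{F}_{q^n}$-dimension at least $h$ and every $h$-dimensional $\mathbb{F}_{q^n}$-subspace meets $U$ in an $\mathbb{F}_q$-subspace of $\mathbb{F}_q$-dimension at most $k$. -}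

module Defs where

open import Level using (0ℓ)
open import Algebra.Bundles using (CommutativeRing)
open import Data.Nat using (ℕ; zero; suc; _≤_)
open import Data.Fin using (Fin; zero; suc)
open import Data.Product using (Σ; ∃; _×_)
open import Data.Unit using (⊤)
open import Relation.Nullary using (¬_)
open import Relation.Binary.Definitions using (Decidable)
open import Relation.Binary.PropositionalEquality using (_≡_)

-- A "scalar predicate" S : Carrier → Set selects the allowed scalars:
-- S = K gives K-linear notions, S = AllScalars gives F-linear notions.
module LinAlg (R : CommutativeRing 0ℓ 0ℓ) where
  open CommutativeRing R using (Carrier; _≈_; _+_; _*_; -_; 0#; 1#)

  record IsField : Set where
    field
      0≉1     : ¬ (0# ≈ 1#)
      inverse : ∀ x → ¬ (x ≈ 0#) → ∃ λ y → (x * y) ≈ 1#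
      -- finite fields have decidable equality
      _≟_     : Decidable _≈_

  record IsSubfield (K : Carrier → Set) : Set where
    field
      resp      : ∀ {x y} → x ≈ y → K x → K y
      0∈        : K 0#
      1∈        : K 1#
      +-closed  : ∀ {x y} → K x → K y → K (x + y)
      neg-closed : ∀ {x} → K x → K (- x)
      *-closed  : ∀ {x y} → K x → K y → K (x * y)
      inv-closed : ∀ {x y} → K x → (x * y) ≈ 1# → K y

  HasOrder : (Carrier → Set) → ℕ → Set
  HasOrder K q = Σ (Fin q → Carrier) λ e →
      (∀ i → K (e i))
    × (∀ i j → e i ≈ e j → i ≡ j)
    × (∀ x → K x → ∃ λ i → x ≈ e i)

  AllScalars : Carrier → Set
  AllScalars _ = ⊤

  V : ℕ → Set
  V m = Fin m → Carrier

  _≈ᵥ_ : ∀ {m} → V m → V m → Set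
  u ≈ᵥ v = ∀ i → u i ≈ v i

  0ᵥ : ∀ {m} → V m
  0ᵥ _ = 0#

  _+ᵥ_ : ∀ {m} → V m → V m → V m
  (u +ᵥ v) i = u i + v i

  _·_ : ∀ {m} → Carrier → V m → V m
  (a · v) i = a * v i

  ∑ : ∀ {m k} → (Fin k → V m) → V m
  ∑ {k = zero}  f = 0ᵥ
  ∑ {k = suc k} f = f zero +ᵥ ∑ (λ i → f (suc i))

  lincomb : ∀ {m k} → (Fin k → Carrier) → (Fin k → V m) → V m
  lincomb c v = ∑ (λ i → c i · v i)

  Independent : (Carrier → Set) → ∀ {m k} → (Fin k → V m) → Set
  Independent S v = ∀ c → (∀ i → S (c i)) → lincomb c v ≈ᵥ 0ᵥ → ∀ i → c i ≈ 0#

  InSpanOf : (Carrier → Set) → ∀ {m k} → (Fin k → V m) → V m → Set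
  InSpanOf S v x = Σ (Fin _ → Carrier) λ c → (∀ i → S (c i)) × (lincomb c v ≈ᵥ x)

  record IsSubspace (S : Carrier → Set) {m : ℕ} (U : V m → Set) : Set where
    field
      resp     : ∀ {x y} → x ≈ᵥ y → U x → U y
      0∈       : U 0ᵥ
      +-closed : ∀ {x y} → U x → U y → U (x +ᵥ y)
      ·-closed : ∀ {a x} → S a → U x → U (a · x)

  HasDim : (Carrier → Set) → ∀ {m} → (V m → Set) → ℕ → Set
  HasDim S {m} U d = Σ (Fin d → V m) λ b →
      (∀ i → U (b i)) × Independent S b × (∀ x → U x → InSpanOf S b x)

  SpanOf : (Carrier → Set) → ∀ {m} → (V m → Set) → V m → Set
  SpanOf S {m} U x = Σ ℕ λ k → Σ (Fin k → V m) λ v → (∀ i → U (v i)) × InSpanOf S v x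

  -- [F : K] = n : F (= F^1) has K-dimension n
  ExtensionDegree : (Carrier → Set) → ℕ → Set
  ExtensionDegree K n = HasDim K {1} (λ _ → ⊤) n

  IsEvasive : (Carrier → Set) → ∀ {m} → ℕ → ℕ → (V m → Set) → Set₁
  IsEvasive K {m} h k U =
      (∃ λ e → h ≤ e × HasDim AllScalars (SpanOf AllScalars U) e)
    × (∀ (W : V m → Set) → IsSubspace AllScalars W → HasDim AllScalars W h →
         ∃ λ e → e ≤ k × HasDim K (λ x → U x × W x) e)

-- Let U ⊆ F^r be
-- (r-1,k)_K-evasive of K-dimension d, β₀,…,β_{s-1} ∈ F K-independent
-- (s ≤ n = [F:K]), A = ⟨β⟩_K, and Lift A U = {x ∈ F^{r+1} : x₀ ∈ A, (x₁,…,x_r) ∈ U}.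
-- Lift A U has K-dimension d + s, and its F-span is F e₀ ⊕ (0 × ⟨U⟩_F).  For an
-- F-subspace W of F-dimension r, X = Lift A U ∩ W is bounded as follows: if
-- W ⊆ {x₀ = 0}, the tail map embeds X into U, so dim_K X ≤ d ≤ k + s;
-- otherwise W ∩ {x₀ = 0} = 0 × W₁ with dim_F W₁ = r - 1, the head-zero part
-- of X embeds into U ∩ W₁ (dimension ≤ k), and modulo it X is spanned by the
-- s vectors (βₗ, 0), so an exchange argument gives dim_K X ≤ k + s.  Since
-- K and F are finite, membership in X is decidable and a greedy search gives
-- X a K-basis, i.e. a dimension.
module Submission where

open import Level using (0ℓ)
open import Algebra.Bundles using (CommutativeRing)
open import Data.Nat as ℕ using (ℕ; zero; suc; z≤n; s≤s)
import Data.Nat.Properties as ℕP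
open import Data.Fin as Fin using (Fin; zero; suc; punchIn; punchOut; _↑ˡ_; _↑ʳ_)
import Data.Fin.Properties as FinP
open import Data.Vec.Functional using (_∷_; tail; _++_; insertAt; removeAt)
open import Data.Vec.Functional.Properties
  using (lookup-++ˡ; lookup-++ʳ; insertAt-lookup; insertAt-punchIn)
open import Data.Sum using (_⊎_; inj₁; inj₂)
open import Data.Product using (Σ; ∃; _×_; _,_; proj₁; proj₂)
open import Data.Unit using (⊤; tt)
open import Data.Empty using (⊥-elim)
open import Relation.Nullary using (¬_; Dec; yes; no; ¬?)
open import Relation.Nullary.Decidable using (decidable-stable; _×-dec_)
open import Relation.Binary.PropositionalEquality as PE using (_≡_)
import Relation.Binary.Reasoning.Setoid as SetoidReasoning
open import Defs

Searchable : (A : Set) → (A → A → Set) → Set₁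
Searchable A _~_ =
  ∀ (P : A → Set) → (∀ {a b} → a ~ b → P a → P b) → (∀ a → Dec (P a)) → Dec (∃ P)

finSearch : ∀ q → Searchable (Fin q) _≡_
finSearch q P _ P? = FinP.any? P?

funSearch : ∀ {A : Set} {_~_ : A → A → Set} → (∀ {a} → a ~ a) → Searchable A _~_ →
  ∀ len → Searchable (Fin len → A) (λ g h → ∀ i → g i ~ h i)
funSearch ~-refl search zero P resp P? with P? (λ ())
... | yes p = yes (_ , p)
... | no ¬p = no λ (g , pg) → ¬p (resp (λ ()) pg)
funSearch {A} {_~_} ~-refl search (suc len) P resp P? with search WithHead withHead-resp withHead?
  where
  WithHead : A → Set
  WithHead a = ∃ λ g → P (a ∷ g)
  withHead-resp : ∀ {a b} → a ~ b → WithHead a → WithHead b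
  withHead-resp a~b (g , p) = g , resp (λ { zero → a~b ; (suc i) → ~-refl }) p
  withHead? : ∀ a → Dec (WithHead a)
  withHead? a = funSearch ~-refl search len (λ g → P (a ∷ g))
    (λ g~h → resp (λ { zero → ~-refl ; (suc i) → g~h i })) (λ g → P? (a ∷ g))
... | yes (a , g , p) = yes (a ∷ g , p)
... | no ¬p = no λ (g , pg) → ¬p (g zero , tail g , resp (λ { zero → ~-refl ; (suc i) → ~-refl }) pg)

module LinearAlgebra (R : CommutativeRing 0ℓ 0ℓ) (isField : LinAlg.IsField R) where
  open CommutativeRing R hiding (zero)
  open LinAlg R
  open IsField isField
  open import Algebra.Properties.CommutativeMonoid.Sum +-commutativeMonoid
    using (sum; sum-remove; ∑-distrib-+)
  open import Algebra.Properties.Ring ring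
    using (-‿distribˡ-*; -‿distribʳ-*; +-inverseʳ-unique; -‿involutive)
  open import Algebra.Properties.CommutativeSemigroup +-commutativeSemigroup
    using () renaming (interchange to +-interchange)
  open SetoidReasoning setoid

  undo-pivot : ∀ a {t y} → t * y ≈ 1# → (a * y) * t ≈ a
  undo-pivot a {t} {y} ty≈1 = begin
    (a * y) * t  ≈⟨ *-assoc a y t ⟩
    a * (y * t)  ≈⟨ *-congˡ (trans (*-comm y t) ty≈1) ⟩
    a * 1#       ≈⟨ *-identityʳ a ⟩
    a            ∎

  *-cancelʳ : ∀ {a b t y} → t * y ≈ 1# → a * t ≈ b * t → a ≈ b
  *-cancelʳ {a} {b} {t} {y} ty≈1 at≈bt = begin
    a            ≈⟨ sym (undo-pivot a (trans (*-comm y t) ty≈1)) ⟩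
    (a * t) * y  ≈⟨ *-congʳ at≈bt ⟩
    (b * t) * y  ≈⟨ undo-pivot b (trans (*-comm y t) ty≈1) ⟩
    b            ∎

  pivot-cancels : ∀ a {t y} → t * y ≈ 1# → a + (- (a * y)) * t ≈ 0#
  pivot-cancels a {t} {y} ty≈1 = begin
    a + (- (a * y)) * t  ≈⟨ +-congˡ (sym (-‿distribˡ-* (a * y) t)) ⟩
    a + - ((a * y) * t)  ≈⟨ +-congˡ (-‿cong (undo-pivot a ty≈1)) ⟩
    a + - a              ≈⟨ -‿inverseʳ a ⟩
    0#                   ∎

  ≈ᵥ-refl : ∀ {m} {u : V m} → u ≈ᵥ u
  ≈ᵥ-refl i = refl

  ≈ᵥ-sym : ∀ {m} {u v : V m} → u ≈ᵥ v → v ≈ᵥ u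
  ≈ᵥ-sym p i = sym (p i)

  ≈ᵥ-trans : ∀ {m} {u v w : V m} → u ≈ᵥ v → v ≈ᵥ w → u ≈ᵥ w
  ≈ᵥ-trans p q i = trans (p i) (q i)

  +ᵥ-cong : ∀ {m} {u u′ v v′ : V m} → u ≈ᵥ u′ → v ≈ᵥ v′ → (u +ᵥ v) ≈ᵥ (u′ +ᵥ v′)
  +ᵥ-cong p q i = +-cong (p i) (q i)

  ·-cong : ∀ {m} {a b} {u v : V m} → a ≈ b → u ≈ᵥ v → (a · u) ≈ᵥ (b · v)
  ·-cong p q i = *-cong p (q i)

  decV : ∀ {m} (u v : V m) → Dec (u ≈ᵥ v)
  decV u v = FinP.all? (λ i → u i ≟ v i)

  -- Laws of the vector sum ∑; a coordinate of ∑ is the scalar sum of the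
  -- coordinates, which lets us reuse the library's laws of scalar sums.
  ∑-cong : ∀ {m k} {f g : Fin k → V m} → (∀ i → f i ≈ᵥ g i) → ∑ f ≈ᵥ ∑ g
  ∑-cong {k = zero}  p j = refl
  ∑-cong {k = suc k} p   = +ᵥ-cong (p zero) (∑-cong (λ i → p (suc i)))

  ∑-zero : ∀ {m k} (f : Fin k → V m) → (∀ i → f i ≈ᵥ 0ᵥ) → ∑ f ≈ᵥ 0ᵥ
  ∑-zero {k = zero}  f p j = refl
  ∑-zero {k = suc k} f p j =
    trans (+-cong (p zero j) (∑-zero (λ i → f (suc i)) (λ i → p (suc i)) j)) (+-identityʳ 0#)

  ∑-coord : ∀ {m k} (f : Fin k → V m) j → ∑ f j ≈ sum (λ i → f i j)
  ∑-coord {k = zero}  f j = refl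
  ∑-coord {k = suc k} f j = +-congˡ (∑-coord (λ i → f (suc i)) j)

  ∑-+ : ∀ {m k} (f g : Fin k → V m) → ∑ (λ i → f i +ᵥ g i) ≈ᵥ (∑ f +ᵥ ∑ g)
  ∑-+ f g j = begin
    ∑ (λ i → f i +ᵥ g i) j                ≈⟨ ∑-coord (λ i → f i +ᵥ g i) j ⟩
    sum (λ i → f i j + g i j)             ≈⟨ ∑-distrib-+ (λ i → f i j) (λ i → g i j) ⟩
    sum (λ i → f i j) + sum (λ i → g i j) ≈⟨ sym (+-cong (∑-coord f j) (∑-coord g j)) ⟩
    ∑ f j + ∑ g j                         ∎

  ∑-· : ∀ {m k} (a : Carrier) (f : Fin k → V m) → ∑ (λ i → a · f i) ≈ᵥ (a · ∑ f)
  ∑-· {k = zero}  a f j = sym (zeroʳ a)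
  ∑-· {k = suc k} a f j = trans (+-congˡ (∑-· a (λ i → f (suc i)) j)) (sym (distribˡ _ _ _))

  ∑-scalars : ∀ {m k} (a : Fin k → Carrier) (x : V m) → ∑ (λ i → a i · x) ≈ᵥ (sum a · x)
  ∑-scalars {k = zero}  a x j = sym (zeroˡ (x j))
  ∑-scalars {k = suc k} a x j =
    trans (+-congˡ (∑-scalars (λ i → a (suc i)) x j)) (sym (distribʳ _ _ _))

  ∑-remove : ∀ {m k} (f : Fin (suc k) → V m) i → ∑ f ≈ᵥ (f i +ᵥ ∑ (removeAt f i))
  ∑-remove f i j = begin
    ∑ f j                                     ≈⟨ ∑-coord f j ⟩
    sum (λ l → f l j)                         ≈⟨ sum-remove (λ l → f l j) ⟩
    f i j + sum (λ l → f (punchIn i l) j)     ≈⟨ +-congˡ (sym (∑-coord (removeAt f i) j)) ⟩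
    f i j + ∑ (removeAt f i) j                ∎

  ∑-split : ∀ {m} a b (f : Fin (a ℕ.+ b) → V m) →
    ∑ f ≈ᵥ (∑ (λ i → f (i ↑ˡ b)) +ᵥ ∑ (λ j → f (a ↑ʳ j)))
  ∑-split zero    b f j = sym (+-identityˡ _)
  ∑-split (suc a) b f j = trans (+-congˡ (∑-split a b (λ i → f (suc i)) j)) (sym (+-assoc _ _ _))

  lincomb-cong : ∀ {m k} {c c′ : Fin k → Carrier} {v v′ : Fin k → V m} →
    (∀ i → c i ≈ c′ i) → (∀ i → v i ≈ᵥ v′ i) → lincomb c v ≈ᵥ lincomb c′ v′
  lincomb-cong p q = ∑-cong (λ i → ·-cong (p i) (q i))

  lincomb-+ᵥ : ∀ {m k} (c : Fin k → Carrier) (f g : Fin k → V m) →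
    lincomb c (λ i → f i +ᵥ g i) ≈ᵥ (lincomb c f +ᵥ lincomb c g)
  lincomb-+ᵥ c f g = ≈ᵥ-trans (∑-cong (λ i j → distribˡ (c i) (f i j) (g i j)))
                              (∑-+ (λ i → c i · f i) (λ i → c i · g i))

  lincomb-+ : ∀ {m k} (c d : Fin k → Carrier) (f : Fin k → V m) →
    lincomb (λ i → c i + d i) f ≈ᵥ (lincomb c f +ᵥ lincomb d f)
  lincomb-+ c d f = ≈ᵥ-trans (∑-cong (λ i j → distribʳ (f i j) (c i) (d i)))
                             (∑-+ (λ i → c i · f i) (λ i → d i · f i))

  lincomb-* : ∀ {m k} (a : Carrier) (c : Fin k → Carrier) (f : Fin k → V m) →
    lincomb (λ i → a * c i) f ≈ᵥ (a · lincomb c f)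
  lincomb-* a c f = ≈ᵥ-trans (∑-cong (λ i j → *-assoc a (c i) (f i j))) (∑-· a (λ i → c i · f i))

  lincomb-zeroᶜ : ∀ {m k} (c : Fin k → Carrier) (f : Fin k → V m) →
    (∀ i → c i ≈ 0#) → lincomb c f ≈ᵥ 0ᵥ
  lincomb-zeroᶜ c f c≈0 = ∑-zero _ (λ i j → trans (*-congʳ (c≈0 i)) (zeroˡ (f i j)))

  lincomb-zeroᵛ : ∀ {m k} (c : Fin k → Carrier) (f : Fin k → V m) →
    (∀ i → f i ≈ᵥ 0ᵥ) → lincomb c f ≈ᵥ 0ᵥ
  lincomb-zeroᵛ c f f≈0 = ∑-zero _ (λ i j → trans (*-congˡ (f≈0 i j)) (zeroʳ (c i)))

  lincomb-remove : ∀ {m k} (c : Fin (suc k) → Carrier) (v : Fin (suc k) → V m) i →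
    lincomb c v ≈ᵥ ((c i · v i) +ᵥ lincomb (removeAt c i) (removeAt v i))
  lincomb-remove c v i = ∑-remove (λ l → c l · v l) i

  lincomb-split : ∀ {m} a b (c : Fin (a ℕ.+ b) → Carrier) (v : Fin (a ℕ.+ b) → V m) →
    lincomb c v ≈ᵥ (lincomb (λ i → c (i ↑ˡ b)) (λ i → v (i ↑ˡ b))
                    +ᵥ lincomb (λ j → c (a ↑ʳ j)) (λ j → v (a ↑ʳ j)))
  lincomb-split a b c v = ∑-split a b (λ l → c l · v l)

  lincomb-reindex : ∀ {m m′ k} (σ : Fin m′ → Fin m) (c : Fin k → Carrier) (v : Fin k → V m) j →
    lincomb c v (σ j) ≈ lincomb c (λ i l → v i (σ l)) j
  lincomb-reindex {k = zero}  σ c v j = refl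
  lincomb-reindex {k = suc k} σ c v j = +-congˡ (lincomb-reindex σ (λ i → c (suc i)) (λ i → v (suc i)) j)

  lincomb-head : ∀ {m k} (c : Fin k → Carrier) (v : Fin k → V (suc m)) →
    lincomb c v zero ≈ lincomb c (λ i (_ : Fin 1) → v i zero) zero
  lincomb-head c v = lincomb-reindex (λ _ → zero) c v zero

  lincomb-tail : ∀ {m k} (c : Fin k → Carrier) (v : Fin k → V (suc m)) j →
    lincomb c v (suc j) ≈ lincomb c (λ i → tail (v i)) j
  lincomb-tail c v j = lincomb-reindex suc c v j

  lincomb-headZero : ∀ {m k} (c : Fin k → Carrier) (v : Fin k → V (suc m)) →
    (∀ i → v i zero ≈ 0#) → lincomb c v zero ≈ 0#
  lincomb-headZero c v hz =
    trans (lincomb-head c v) (lincomb-zeroᵛ c (λ i _ → v i zero) (λ i _ → hz i) zero)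

  split-all : ∀ {a b} (P : Fin (a ℕ.+ b) → Set) →
    (∀ i → P (i ↑ˡ b)) → (∀ j → P (a ↑ʳ j)) → ∀ k → P k
  split-all {a} {b} P pˡ pʳ k = PE.subst P (FinP.join-splitAt a b k) (joined (Fin.splitAt a k))
    where
    joined : ∀ x → P (Fin.join a b x)
    joined (inj₁ i) = pˡ i
    joined (inj₂ j) = pʳ j

  ++-all : ∀ {A : Set} {a b} (P : A → Set) (f : Fin a → A) (g : Fin b → A) →
    (∀ i → P (f i)) → (∀ j → P (g j)) → ∀ k → P ((f ++ g) k)
  ++-all P f g pf pg = split-all (λ k → P ((f ++ g) k))
    (λ i → PE.subst P (PE.sym (lookup-++ˡ f g i)) (pf i))
    (λ j → PE.subst P (PE.sym (lookup-++ʳ f g j)) (pg j))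

  insertAt-all : ∀ {A : Set} {a} (P : A → Set) (xs : Fin a → A) i x →
    P x → (∀ j → P (xs j)) → ∀ k → P (insertAt xs i x k)
  insertAt-all P xs i x px pxs k with i Fin.≟ k
  ... | yes PE.refl = PE.subst P (PE.sym (insertAt-lookup xs i x)) px
  ... | no i≢k = PE.subst (λ l → P (insertAt xs i x l)) (FinP.punchIn-punchOut i≢k)
                   (PE.subst P (PE.sym (insertAt-punchIn xs i x (punchOut i≢k))) (pxs _))

  unit : ∀ {k} → Fin (suc k) → Fin (suc k) → Carrier
  unit i = insertAt (λ _ → 0#) i 1#

  lincomb-unit : ∀ {m k} (v : Fin (suc k) → V m) i → lincomb (unit i) v ≈ᵥ v i
  lincomb-unit v i j = begin
    lincomb (unit i) v j
      ≈⟨ lincomb-remove (unit i) v i j ⟩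
    unit i i * v i j + lincomb (removeAt (unit i) i) (removeAt v i) j
      ≈⟨ +-cong (*-congʳ (reflexive (insertAt-lookup _ i 1#)))
                (lincomb-zeroᶜ _ _ (λ l → reflexive (insertAt-punchIn _ i 1# l)) j) ⟩
    1# * v i j + 0#
      ≈⟨ trans (+-identityʳ _) (*-identityˡ _) ⟩
    v i j ∎

  eliminate : ∀ {m a} (v : Fin (suc a) → V m) (i₀ : Fin (suc a)) (μ : Fin a → Carrier) → Fin a → V m
  eliminate v i₀ μ j = removeAt v i₀ j +ᵥ (μ j · v i₀)

  eliminate-lincomb : ∀ {m a} (v : Fin (suc a) → V m) i₀ (μ c : Fin a → Carrier) →
    lincomb c (eliminate v i₀ μ) ≈ᵥ (lincomb c (removeAt v i₀) +ᵥ (sum (λ j → c j * μ j) · v i₀))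
  eliminate-lincomb v i₀ μ c = ≈ᵥ-trans (lincomb-+ᵥ c _ _) (+ᵥ-cong ≈ᵥ-refl
    (≈ᵥ-trans (∑-cong (λ j k → sym (*-assoc (c j) (μ j) (v i₀ k)))) (∑-scalars (λ j → c j * μ j) (v i₀))))

  module OverSubfield {S : Carrier → Set} (S-subfield : IsSubfield S) where
    private
      module SF = IsSubfield S-subfield

    sum∈ : ∀ {k} (a : Fin k → Carrier) → (∀ i → S (a i)) → S (sum a)
    sum∈ {zero}  a a∈ = SF.0∈
    sum∈ {suc k} a a∈ = SF.+-closed (a∈ zero) (sum∈ (λ i → a (suc i)) (λ i → a∈ (suc i)))

    lincomb∈ : ∀ {m k} {U : V m → Set} → IsSubspace S U → (c : Fin k → Carrier) (w : Fin k → V m) →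
      (∀ i → S (c i)) → (∀ i → U (w i)) → U (lincomb c w)
    lincomb∈ {k = zero}  sU c w c∈ w∈ = IsSubspace.0∈ sU
    lincomb∈ {k = suc k} sU c w c∈ w∈ =
      IsSubspace.+-closed sU (IsSubspace.·-closed sU (c∈ zero) (w∈ zero))
        (lincomb∈ sU (λ i → c (suc i)) (λ i → w (suc i)) (λ i → c∈ (suc i)) (λ i → w∈ (suc i)))

    span-isSubspace : ∀ {m k} (w : Fin k → V m) → IsSubspace S (InSpanOf S w)
    span-isSubspace w = record
      { resp     = λ { x≈y (c , c∈ , eq) → c , c∈ , ≈ᵥ-trans eq x≈y }
      ; 0∈       = (λ _ → 0#) , (λ _ → SF.0∈) , lincomb-zeroᶜ _ w (λ _ → refl)
      ; +-closed = λ { (c , c∈ , eq) (d , d∈ , eq′) →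
          (λ i → c i + d i) , (λ i → SF.+-closed (c∈ i) (d∈ i)) ,
          ≈ᵥ-trans (lincomb-+ c d w) (+ᵥ-cong eq eq′) }
      ; ·-closed = λ { {a} a∈ (c , c∈ , eq) →
          (λ i → a * c i) , (λ i → SF.*-closed a∈ (c∈ i)) ,
          ≈ᵥ-trans (lincomb-* a c w) (·-cong refl eq) } }

    member∈span : ∀ {m k} (w : Fin k → V m) i → InSpanOf S w (w i)
    member∈span {k = suc k} w i =
      unit i , insertAt-all S _ i 1# SF.1∈ (λ _ → SF.0∈) , lincomb-unit w i

    span-hasDim : ∀ {m k} (w : Fin k → V m) → Independent S w → HasDim S (InSpanOf S w) k
    span-hasDim w ind = w , member∈span w , ind , λ _ x∈ → x∈

    independent-nonzero : ∀ {m k} (v : Fin k → V m) → Independent S v → ∀ i → ¬ (v i ≈ᵥ 0ᵥ)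
    independent-nonzero {k = suc k} v ind i vᵢ≈0 = 0≉1 (begin
      0#        ≈⟨ sym (ind (unit i) unit∈ (≈ᵥ-trans (lincomb-unit v i) vᵢ≈0) i) ⟩
      unit i i  ≈⟨ reflexive (insertAt-lookup _ i 1#) ⟩
      1#        ∎)
      where
      unit∈ : ∀ l → S (unit i l)
      unit∈ = insertAt-all S _ i 1# SF.1∈ (λ _ → SF.0∈)

    independent-prefix : ∀ {m a b} (v : Fin (a ℕ.+ b) → V m) → Independent S v →
      Independent S (λ i → v (i ↑ˡ b))
    independent-prefix {a = a} {b} v ind c c∈ eq i =
      trans (sym (reflexive (lookup-++ˡ c zeros i))) (ind (c ++ zeros) c++zeros∈ combination≈0 (i ↑ˡ b))
      where
      zeros : Fin b → Carrier
      zeros _ = 0#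
      c++zeros∈ = ++-all S c zeros c∈ (λ _ → SF.0∈)
      combination≈0 : lincomb (c ++ zeros) v ≈ᵥ 0ᵥ
      combination≈0 j = begin
        lincomb (c ++ zeros) v j
          ≈⟨ lincomb-split a b (c ++ zeros) v j ⟩
        lincomb (λ l → (c ++ zeros) (l ↑ˡ b)) (λ l → v (l ↑ˡ b)) j
          + lincomb (λ l → (c ++ zeros) (a ↑ʳ l)) (λ l → v (a ↑ʳ l)) j
          ≈⟨ +-cong (trans (lincomb-cong (λ l → reflexive (lookup-++ˡ c zeros l)) (λ _ → ≈ᵥ-refl) j) (eq j))
                    (lincomb-zeroᶜ _ _ (λ l → reflexive (lookup-++ʳ c zeros l)) j) ⟩
        0# + 0#
          ≈⟨ +-identityʳ 0# ⟩
        0# ∎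

    independent-subfamily : ∀ {m n s} (v : Fin n → V m) → Independent S v → s ℕ.≤ n →
      Σ (Fin s → V m) (Independent S)
    independent-subfamily v ind s≤n with ℕP.m≤n⇒∃[o]m+o≡n s≤n
    ... | _ , PE.refl = _ , independent-prefix v ind

    tails-independent : ∀ {m a} (f : Fin a → V (suc m)) → (∀ i → f i zero ≈ 0#) →
      Independent S f → Independent S (λ i → tail (f i))
    tails-independent f hz ind c c∈ eq = ind c c∈ combination≈0
      where
      combination≈0 : lincomb c f ≈ᵥ 0ᵥ
      combination≈0 zero    = lincomb-headZero c f hz
      combination≈0 (suc j) = trans (lincomb-tail c f j) (eq j)

    eliminate-independent : ∀ {m a} (v : Fin (suc a) → V m) i₀ (μ : Fin a → Carrier) →
      Independent S v → (∀ j → S (μ j)) → Independent S (eliminate v i₀ μ)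
    eliminate-independent v i₀ μ ind μ∈ c′ c′∈ eq j =
      trans (sym (reflexive (insertAt-punchIn c′ i₀ τ j))) (ind c c∈ combination≈0 (punchIn i₀ j))
      where
      τ = sum (λ l → c′ l * μ l)
      c = insertAt c′ i₀ τ
      c∈ : ∀ l → S (c l)
      c∈ = insertAt-all S c′ i₀ τ (sum∈ _ (λ l → SF.*-closed (c′∈ l) (μ∈ l))) c′∈
      combination≈0 : lincomb c v ≈ᵥ 0ᵥ
      combination≈0 k = begin
        lincomb c v k
          ≈⟨ lincomb-remove c v i₀ k ⟩
        c i₀ * v i₀ k + lincomb (removeAt c i₀) (removeAt v i₀) k
          ≈⟨ +-cong (*-congʳ (reflexive (insertAt-lookup c′ i₀ τ)))
                    (lincomb-cong (λ l → reflexive (insertAt-punchIn c′ i₀ τ l)) (λ _ → ≈ᵥ-refl) k) ⟩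
        τ * v i₀ k + lincomb c′ (removeAt v i₀) k
          ≈⟨ +-comm _ _ ⟩
        lincomb c′ (removeAt v i₀) k + τ * v i₀ k
          ≈⟨ sym (eliminate-lincomb v i₀ μ c′ k) ⟩
        lincomb c′ (eliminate v i₀ μ) k
          ≈⟨ eq k ⟩
        0# ∎

    extend-independent : ∀ {m a} (f : Fin a → V m) (x : V m) → Independent S f →
      ¬ InSpanOf S f x → Independent S (x ∷ f)
    extend-independent f x ind x∉ c c∈ eq i with c zero ≟ 0#
    ... | yes c₀≈0 = c≈0 i
      where
      tail≈0 : lincomb (tail c) f ≈ᵥ 0ᵥ
      tail≈0 k = trans (sym (trans (+-congʳ (trans (*-congʳ c₀≈0) (zeroˡ (x k)))) (+-identityˡ _))) (eq k)
      c≈0 : ∀ i → c i ≈ 0#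
      c≈0 zero    = c₀≈0
      c≈0 (suc i) = ind (tail c) (λ l → c∈ (suc l)) tail≈0 i
    ... | no c₀≉0 = ⊥-elim (x∉ ((λ l → - y * c (suc l)) , coeffs∈ , combination≈x))
      where
      y = proj₁ (inverse (c zero) c₀≉0)
      c₀y≈1 = proj₂ (inverse (c zero) c₀≉0)
      coeffs∈ : ∀ l → S (- y * c (suc l))
      coeffs∈ l = SF.*-closed (SF.neg-closed (SF.inv-closed (c∈ zero) c₀y≈1)) (c∈ (suc l))
      -- c₀ x + L ≈ 0, so x ≈ -(1/c₀) L
      combination≈x : lincomb (λ l → - y * c (suc l)) f ≈ᵥ x
      combination≈x k = begin
        lincomb (λ l → - y * c (suc l)) f k  ≈⟨ lincomb-* (- y) (tail c) f k ⟩
        - y * lincomb (tail c) f k           ≈⟨ *-congˡ (+-inverseʳ-unique _ _ (eq k)) ⟩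
        - y * - (c zero * x k)               ≈⟨ sym (-‿distribˡ-* y _) ⟩
        - (y * - (c zero * x k))             ≈⟨ -‿cong (sym (-‿distribʳ-* y _)) ⟩
        - - (y * (c zero * x k))             ≈⟨ -‿involutive _ ⟩
        y * (c zero * x k)                   ≈⟨ sym (*-assoc y (c zero) (x k)) ⟩
        (y * c zero) * x k                   ≈⟨ *-congʳ (trans (*-comm y (c zero)) c₀y≈1) ⟩
        1# * x k                             ≈⟨ *-identityˡ (x k) ⟩
        x k                                  ∎

    record Decomposition {m j} (Z : V m → Set) (β : Fin j → V m) (x : V m) : Set where
      field
        rest    : V m
        coeffs  : Fin j → Carrier
        rest∈   : Z rest
        coeffs∈ : ∀ l → S (coeffs l)
        splits  : x ≈ᵥ (rest +ᵥ lincomb coeffs β)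

    drop-first : ∀ {m j} {Z : V m → Set} {β : Fin (suc j) → V m} {x} (δ : Decomposition Z β x) →
      Decomposition.coeffs δ zero ≈ 0# → Decomposition Z (tail β) x
    drop-first {β = β} δ c₀≈0 = record
      { rest = rest ; coeffs = tail coeffs ; rest∈ = rest∈ ; coeffs∈ = λ l → coeffs∈ (suc l)
      ; splits = λ k → trans (splits k) (+-congˡ (trans (+-congʳ first≈0) (+-identityˡ _))) }
      where
      open Decomposition δ
      first≈0 : ∀ {k} → coeffs zero * β zero k ≈ 0#
      first≈0 {k} = trans (*-congʳ c₀≈0) (zeroˡ (β zero k))

    combine : ∀ {m j} {Z : V m → Set} {β : Fin j → V m} {x x′ μ} → IsSubspace S Z → S μ →
      Decomposition Z β x → Decomposition Z β x′ → Decomposition Z β (x +ᵥ (μ · x′))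
    combine {β = β} {x} {x′} {μ} Z-sub μ∈ δ δ′ = record
      { rest    = D.rest +ᵥ (μ · D′.rest)
      ; coeffs  = c
      ; rest∈   = IsSubspace.+-closed Z-sub D.rest∈ (IsSubspace.·-closed Z-sub μ∈ D′.rest∈)
      ; coeffs∈ = λ r → SF.+-closed (D.coeffs∈ r) (SF.*-closed μ∈ (D′.coeffs∈ r))
      ; splits  = splits }
      where
      module D = Decomposition δ
      module D′ = Decomposition δ′
      c : Fin _ → Carrier
      c r = D.coeffs r + μ * D′.coeffs r
      combined : lincomb c β ≈ᵥ (lincomb D.coeffs β +ᵥ (μ · lincomb D′.coeffs β))
      combined = ≈ᵥ-trans (lincomb-+ D.coeffs (λ r → μ * D′.coeffs r) β)
                          (+ᵥ-cong ≈ᵥ-refl (lincomb-* μ D′.coeffs β))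
      splits : (x +ᵥ (μ · x′)) ≈ᵥ ((D.rest +ᵥ (μ · D′.rest)) +ᵥ lincomb c β)
      splits k = begin
        x k + μ * x′ k
          ≈⟨ +-cong (D.splits k) (*-congˡ (D′.splits k)) ⟩
        (D.rest k + L) + μ * (D′.rest k + L′)
          ≈⟨ +-congˡ (distribˡ μ _ _) ⟩
        (D.rest k + L) + (μ * D′.rest k + μ * L′)
          ≈⟨ +-interchange _ _ _ _ ⟩
        (D.rest k + μ * D′.rest k) + (L + μ * L′)
          ≈⟨ +-congˡ (sym (combined k)) ⟩
        (D.rest k + μ * D′.rest k) + lincomb c β k ∎
        where
        L = lincomb D.coeffs β k
        L′ = lincomb D′.coeffs β k

    -- Pivoting on a member whose β₀-coefficient t is nonzero: adding
    -- -(aⱼ/t) times it to each other member (aⱼ its β₀-coefficient) removes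
    -- β₀ from their decompositions.
    pivot : ∀ {m j a} {Z : V m → Set} → IsSubspace S Z → (β : Fin (suc j) → V m)
      (v : Fin (suc a) → V m) (δ : ∀ i → Decomposition Z β (v i)) (i₀ : Fin (suc a)) →
      ¬ (Decomposition.coeffs (δ i₀) zero ≈ 0#) →
      Σ (Fin a → Carrier) λ μ → (∀ l → S (μ l)) × (∀ l → Decomposition Z (tail β) (eliminate v i₀ μ l))
    pivot Z-sub β v δ i₀ t≉0 = μ , μ∈ , λ l →
      drop-first (combine Z-sub (μ∈ l) (δ (punchIn i₀ l)) (δ i₀)) (pivot-cancels _ ty≈1)
      where
      module δ (i : Fin _) = Decomposition (δ i)
      t = δ.coeffs i₀ zero
      y = proj₁ (inverse t t≉0)
      ty≈1 = proj₂ (inverse t t≉0)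
      μ : Fin _ → Carrier
      μ l = - (δ.coeffs (punchIn i₀ l) zero * y)
      μ∈ : ∀ l → S (μ l)
      μ∈ l = SF.neg-closed (SF.*-closed (δ.coeffs∈ _ zero) (SF.inv-closed (δ.coeffs∈ i₀ zero) ty≈1))

    -- Let Q, Z be S-subspaces such that independent
    -- families in Q ∩ Z have at most κ members.  An independent family in Q
    -- whose members lie in Z + ⟨β⟩_S, for j vectors β, has at most κ + j
    -- members.  (Induction on j, pivoting away one β at a time.)
    module ExchangeBound {m} {Q Z : V m → Set} (Q-sub : IsSubspace S Q) (Z-sub : IsSubspace S Z)
      (κ : ℕ) (κ-bound : ∀ {a} (v : Fin a → V m) → Independent S v →
                         (∀ i → Q (v i)) → (∀ i → Z (v i)) → a ℕ.≤ κ) where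
      private
        module Q = IsSubspace Q-sub
        module Z = IsSubspace Z-sub

      exchange-bound : ∀ j (β : Fin j → V m) {a} (v : Fin a → V m) → Independent S v →
        (∀ i → Q (v i)) → (∀ i → Decomposition Z β (v i)) → a ℕ.≤ κ ℕ.+ j
      exchange-bound zero β v ind v∈Q δ =
        ℕP.≤-trans (κ-bound v ind v∈Q v∈Z) (ℕP.m≤m+n κ 0)
        where
        v∈Z : ∀ i → Z (v i)
        v∈Z i = Z.resp (λ k → sym (trans (splits k) (+-identityʳ _))) rest∈
          where open Decomposition (δ i)
      exchange-bound (suc j) β {zero} v _ _ _ = z≤n
      exchange-bound (suc j) β {suc a} v ind v∈Q δ
        with FinP.any? (λ i → ¬? (Decomposition.coeffs (δ i) zero ≟ 0#))
      ... | no no-pivot =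
        ℕP.≤-trans (exchange-bound j (tail β) v ind v∈Q (λ i → drop-first (δ i) (unused i)))
                   (ℕP.+-monoʳ-≤ κ (ℕP.n≤1+n j))
        where
        unused : ∀ i → Decomposition.coeffs (δ i) zero ≈ 0#
        unused i = decidable-stable (_ ≟ 0#) (λ c≉0 → no-pivot (i , c≉0))
      ... | yes (i₀ , t≉0) with pivot Z-sub β v δ i₀ t≉0
      ...   | μ , μ∈ , δ′ =
        ℕP.≤-trans (s≤s (exchange-bound j (tail β) (eliminate v i₀ μ)
                                        (eliminate-independent v i₀ μ ind μ∈) eliminated∈Q δ′))
                   (ℕP.≤-reflexive (PE.sym (ℕP.+-suc κ j)))
        where
        eliminated∈Q : ∀ l → Q (eliminate v i₀ μ l)
        eliminated∈Q l = Q.+-closed (v∈Q _) (Q.·-closed (μ∈ l) (v∈Q i₀))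

    -- Steinitz: an independent family inside the span of b vectors has at most
    -- b members (the exchange bound with Q everything and Z = 0).
    steinitz : ∀ {m a b} (v : Fin a → V m) (w : Fin b → V m) → Independent S v →
      (∀ i → InSpanOf S w (v i)) → a ℕ.≤ b
    steinitz {m} {b = b} v w ind v∈ =
      ExchangeBound.exchange-bound everything-sub zero-sub 0 no-independent-zeros b w v ind (λ _ → tt) δ
      where
      everything-sub : IsSubspace S (λ (x : V m) → ⊤)
      everything-sub = record { resp = λ _ _ → tt ; 0∈ = tt ; +-closed = λ _ _ → tt ; ·-closed = λ _ _ → tt }
      zero-sub : IsSubspace S (λ (x : V m) → x ≈ᵥ 0ᵥ)
      zero-sub = record
        { resp = λ x≈y x≈0 k → trans (sym (x≈y k)) (x≈0 k) ; 0∈ = λ _ → refl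
        ; +-closed = λ x≈0 y≈0 k → trans (+-cong (x≈0 k) (y≈0 k)) (+-identityʳ 0#)
        ; ·-closed = λ _ x≈0 k → trans (*-congˡ (x≈0 k)) (zeroʳ _) }
      no-independent-zeros : ∀ {a} (u : Fin a → V m) → Independent S u → (∀ i → ⊤) →
        (∀ i → u i ≈ᵥ 0ᵥ) → a ℕ.≤ 0
      no-independent-zeros {zero}  u _   _ _    = z≤n
      no-independent-zeros {suc a} u ind _ u≈0 = ⊥-elim (independent-nonzero u ind zero (u≈0 zero))
      δ : ∀ i → Decomposition (λ x → x ≈ᵥ 0ᵥ) w (v i)
      δ i = record { rest = 0ᵥ ; coeffs = proj₁ (v∈ i) ; rest∈ = λ _ → refl ; coeffs∈ = proj₁ (proj₂ (v∈ i))
                   ; splits = λ k → sym (trans (+-identityˡ _) (proj₂ (proj₂ (v∈ i)) k)) }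

  -- S is finite: each element of S is (up to ≈) the decoding of a code from
  -- a searchable type of codes.
  record Enumeration (S : Carrier → Set) : Set₁ where
    field
      Code        : Set
      _~_         : Code → Code → Set
      ~-refl      : ∀ {c} → c ~ c
      search      : Searchable Code _~_
      decode      : Code → Carrier
      decode-cong : ∀ {c c′} → c ~ c′ → decode c ≈ decode c′
      decode∈     : ∀ c → S (decode c)
      encode      : ∀ x → S x → Σ Code λ c → x ≈ decode c

  enumeration-of-order : ∀ {S q} → HasOrder S q → Enumeration S
  enumeration-of-order {q = q} (e , e∈ , _ , onto) = record
    { Code = Fin q ; _~_ = _≡_ ; ~-refl = PE.refl ; search = finSearch q
    ; decode = e ; decode-cong = λ c≡c′ → reflexive (PE.cong e c≡c′) ; decode∈ = e∈ ; encode = onto }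

  -- if F has a finite K-basis and K is finite, then F is finite: an element
  -- is coded by the codes of its coordinates
  enumeration-of-extension : ∀ {K n} → Enumeration K → ExtensionDegree K n → Enumeration AllScalars
  enumeration-of-extension {n = n} E (b , _ , _ , b-spans) = record
    { Code = Fin n → E.Code ; _~_ = λ g h → ∀ i → g i E.~ h i ; ~-refl = λ i → E.~-refl
    ; search = funSearch E.~-refl E.search n
    ; decode = decode ; decode-cong = λ g~h → lincomb-cong (λ i → E.decode-cong (g~h i)) (λ _ → ≈ᵥ-refl) zero
    ; decode∈ = λ _ → tt ; encode = encode }
    where
    module E = Enumeration E
    decode : (Fin n → E.Code) → Carrier
    decode g = lincomb (λ i → E.decode (g i)) b zero
    encode : ∀ x → ⊤ → Σ (Fin n → E.Code) λ g → x ≈ decode g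
    encode x _ with b-spans (λ _ → x) tt
    ... | c , c∈ , eq = (λ i → proj₁ (E.encode (c i) (c∈ i))) ,
      trans (sym (eq zero)) (lincomb-cong (λ i → proj₂ (E.encode (c i) (c∈ i))) (λ _ → ≈ᵥ-refl) zero)

  module OverFiniteSubfield {S : Carrier → Set} (S-subfield : IsSubfield S) (E : Enumeration S) where
    open OverSubfield S-subfield
    open Enumeration E

    combination : ∀ {m a} → (Fin a → Code) → (Fin a → V m) → V m
    combination g f = lincomb (λ i → decode (g i)) f

    combination-cong : ∀ {m a} (f : Fin a → V m) {g h : Fin a → Code} →
      (∀ i → g i ~ h i) → combination g f ≈ᵥ combination h f
    combination-cong f g~h = lincomb-cong (λ i → decode-cong (g~h i)) (λ _ → ≈ᵥ-refl)

    encode-span : ∀ {m a} (f : Fin a → V m) x → InSpanOf S f x → ∃ λ g → combination g f ≈ᵥ x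
    encode-span f x (c , c∈ , eq) = (λ i → proj₁ (encode (c i) (c∈ i))) ,
      ≈ᵥ-trans (lincomb-cong (λ i → sym (proj₂ (encode (c i) (c∈ i)))) (λ _ → ≈ᵥ-refl)) eq

    decSpan : ∀ {m a} (f : Fin a → V m) x → Dec (InSpanOf S f x)
    decSpan {a = a} f x
      with funSearch ~-refl search a (λ g → combination g f ≈ᵥ x)
             (λ g~h eq → ≈ᵥ-trans (≈ᵥ-sym (combination-cong f g~h)) eq) (λ g → decV _ x)
    ... | yes (g , eq) = yes ((λ i → decode (g i)) , (λ i → decode∈ (g i)) , eq)
    ... | no ¬found = no λ x∈ → ¬found (encode-span f x x∈)

    decMember : ∀ {m d} {U : V m → Set} → IsSubspace S U → HasDim S U d → ∀ x → Dec (U x)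
    decMember U-sub (b , b∈ , _ , b-spans) x with decSpan b x
    ... | yes (c , c∈ , eq) = yes (IsSubspace.resp U-sub eq (lincomb∈ U-sub c b c∈ b∈))
    ... | no x∉ = no λ x∈U → x∉ (b-spans x x∈U)

    -- Starting from the empty
    -- family, repeatedly adjoin an element of X outside the current span;
    -- by Steinitz this stops after at most D steps.
    module GreedyBasis {m D} (B : Fin D → V m) {X : V m → Set} (X-resp : ∀ {x y} → x ≈ᵥ y → X x → X y)
      (X? : ∀ x → Dec (X x)) (X⊆B : ∀ x → X x → InSpanOf S B x) where

      outside-or-spans : ∀ {a} (f : Fin a → V m) →
        (∃ λ x → X x × ¬ InSpanOf S f x) ⊎ (∀ x → X x → InSpanOf S f x)
      outside-or-spans f
        with funSearch ~-refl search D (λ g → X (combination g B) × ¬ InSpanOf S f (combination g B))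
               (λ g~h (x∈ , x∉) → X-resp (combination-cong B g~h) x∈ ,
                                  λ x∈f → x∉ (IsSubspace.resp (span-isSubspace f) (≈ᵥ-sym (combination-cong B g~h)) x∈f))
               (λ g → X? (combination g B) ×-dec ¬? (decSpan f (combination g B)))
      ... | yes (g , found) = inj₁ (combination g B , found)
      ... | no none = inj₂ spans
        where
        spans : ∀ x → X x → InSpanOf S f x
        spans x x∈ with encode-span B x (X⊆B x x∈)
        ... | g , eq with decSpan f (combination g B)
        ...   | yes g∈f = IsSubspace.resp (span-isSubspace f) eq g∈f
        ...   | no g∉f = ⊥-elim (none (g , X-resp (≈ᵥ-sym eq) x∈ , g∉f))

      grow : ∀ fuel {a} (f : Fin a → V m) → suc D ℕ.≤ a ℕ.+ fuel → (∀ i → X (f i)) → Independent S f →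
        Σ ℕ (HasDim S X)
      grow zero {a} f D<a f∈ ind = ⊥-elim (ℕP.<⇒≱ (ℕP.≤-trans D<a (ℕP.≤-reflexive (ℕP.+-identityʳ a)))
                                                (steinitz f B ind (λ i → X⊆B (f i) (f∈ i))))
      grow (suc fuel) {a} f D<a+fuel f∈ ind with outside-or-spans f
      ... | inj₁ (x , x∈ , x∉) = grow fuel (x ∷ f) (ℕP.≤-trans D<a+fuel (ℕP.≤-reflexive (ℕP.+-suc a fuel)))
                                   (λ { zero → x∈ ; (suc i) → f∈ i }) (extend-independent f x ind x∉)
      ... | inj₂ spans = a , f , f∈ , ind , spans

      basis : Σ ℕ (HasDim S X)
      basis = grow (suc D) {0} (λ ()) ℕP.≤-refl (λ ()) (λ _ _ _ ())

  allScalars-subfield : IsSubfield AllScalars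
  allScalars-subfield = record
    { resp = λ _ _ → tt ; 0∈ = tt ; 1∈ = tt ; +-closed = λ _ _ → tt ; neg-closed = λ _ → tt
    ; *-closed = λ _ _ → tt ; inv-closed = λ _ _ → tt }

  module OverF = OverSubfield allScalars-subfield

  -- Let w be F-independent and let w i₀ have nonzero
  -- head t.  Eliminating with pivot w i₀ clears the heads of the other
  -- members; the tails of the resulting vectors are F-independent and span
  -- every y with (0, y) ∈ ⟨w⟩_F.
  module HyperplaneSection {m a} (w : Fin (suc a) → V (suc m)) (w-ind : Independent AllScalars w)
    (i₀ : Fin (suc a)) (t≉0 : ¬ (w i₀ zero ≈ 0#)) where
    private
      t = w i₀ zero
      y = proj₁ (inverse t t≉0)
      ty≈1 = proj₂ (inverse t t≉0)
      μ : Fin a → Carrier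
      μ j = - (w (punchIn i₀ j) zero * y)
      w′ = eliminate w i₀ μ
      w′-head : ∀ j → w′ j zero ≈ 0#
      w′-head j = pivot-cancels _ ty≈1

    section : Fin a → V m
    section j = tail (w′ j)

    section-independent : Independent AllScalars section
    section-independent =
      OverF.tails-independent w′ w′-head (OverF.eliminate-independent w i₀ μ w-ind (λ _ → tt))

    -- For x = ∑ cᵢ wᵢ with head 0, comparing heads forces c i₀ = ∑ⱼ c′ⱼ μⱼ,
    -- so x is the combination of the eliminated vectors with coefficients c′.
    section-spans : ∀ x → InSpanOf AllScalars w x → x zero ≈ 0# → InSpanOf AllScalars section (tail x)
    section-spans x (c , _ , eq) x₀≈0 = c′ , (λ _ → tt) , λ j → trans (sym (lincomb-tail c′ w′ j)) (w′-combination (suc j))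
      where
      c′ = removeAt c i₀
      L = lincomb c′ (removeAt w i₀)
      τ = sum (λ j → c′ j * μ j)
      x≈ : ∀ k → x k ≈ c i₀ * w i₀ k + L k
      x≈ k = trans (sym (eq k)) (lincomb-remove c w i₀ k)
      w′≈ : ∀ k → lincomb c′ w′ k ≈ L k + τ * w i₀ k
      w′≈ = eliminate-lincomb w i₀ μ c′
      c≈τ : c i₀ ≈ τ
      c≈τ = *-cancelʳ ty≈1 (begin
        c i₀ * t                    ≈⟨ sym (+-identityʳ _) ⟩
        c i₀ * t + 0#               ≈⟨ +-congˡ (trans (sym (lincomb-headZero c′ w′ w′-head)) (w′≈ zero)) ⟩
        c i₀ * t + (L zero + τ * t) ≈⟨ sym (+-assoc _ _ _) ⟩
        (c i₀ * t + L zero) + τ * t ≈⟨ +-congʳ (trans (sym (x≈ zero)) x₀≈0) ⟩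
        0# + τ * t                  ≈⟨ +-identityˡ _ ⟩
        τ * t                       ∎)
      w′-combination : lincomb c′ w′ ≈ᵥ x
      w′-combination k = begin
        lincomb c′ w′ k      ≈⟨ w′≈ k ⟩
        L k + τ * w i₀ k     ≈⟨ +-comm _ _ ⟩
        τ * w i₀ k + L k     ≈⟨ +-congʳ (*-congʳ (sym c≈τ)) ⟩
        c i₀ * w i₀ k + L k  ≈⟨ sym (x≈ k) ⟩
        x k                  ∎

module Lifting (R : CommutativeRing 0ℓ 0ℓ) (isField : LinAlg.IsField R) where
  open CommutativeRing R hiding (zero)
  open LinAlg R
  open IsField isField
  open LinearAlgebra R isField
  open SetoidReasoning setoid

  Lift : ∀ {r} → (V 1 → Set) → (V r → Set) → V (suc r) → Set
  Lift A U x = A (λ _ → x zero) × U (tail x)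

  lift-isSubspace : ∀ {S r} {A : V 1 → Set} {U : V r → Set} →
    IsSubspace S A → IsSubspace S U → IsSubspace S (Lift A U)
  lift-isSubspace A-sub U-sub = record
    { resp     = λ x≈y (a , u) → A.resp (λ { zero → x≈y zero }) a , U.resp (λ i → x≈y (suc i)) u
    ; 0∈       = A.0∈ , U.0∈
    ; +-closed = λ (a , u) (a′ , u′) → A.+-closed a a′ , U.+-closed u u′
    ; ·-closed = λ s∈ (a , u) → A.·-closed s∈ a , U.·-closed s∈ u }
    where
    module A = IsSubspace A-sub
    module U = IsSubspace U-sub

  atHead : ∀ {r} → Carrier → V (suc r)
  atHead a = a ∷ 0ᵥ

  atTail : ∀ {r} → V r → V (suc r)
  atTail u = 0# ∷ u

  atHead-head : ∀ {r k} (c : Fin k → Carrier) (α : Fin k → V 1) →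
    lincomb c (λ i → atHead {r} (α i zero)) zero ≈ lincomb c α zero
  atHead-head c α = trans (lincomb-head c _)
    (lincomb-cong {c = c} {v = λ i _ → α i zero} {v′ = α} (λ _ → refl) (λ i → λ { zero → refl }) zero)

  atHead-tail : ∀ {r k} (c : Fin k → Carrier) (a : Fin k → Carrier) j →
    lincomb c (λ i → atHead {r} (a i)) (suc j) ≈ 0#
  atHead-tail c a j = trans (lincomb-tail c _ j) (lincomb-zeroᵛ c _ (λ _ _ → refl) j)

  atTail-head : ∀ {r k} (c : Fin k → Carrier) (u : Fin k → V r) →
    lincomb c (λ i → atTail (u i)) zero ≈ 0#
  atTail-head c u = lincomb-headZero c _ (λ _ → refl)

  atTail-tail : ∀ {r k} (c : Fin k → Carrier) (u : Fin k → V r) j →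
    lincomb c (λ i → atTail (u i)) (suc j) ≈ lincomb c u j
  atTail-tail c u j = lincomb-tail c _ j

  lift-dim : ∀ {S r d s} {A : V 1 → Set} {U : V r → Set} → IsSubspace S A → IsSubspace S U →
    HasDim S A s → HasDim S U d → HasDim S (Lift A U) (d ℕ.+ s)
  lift-dim {S} {r} {d} {s} {A} {U} A-sub U-sub (α , α∈ , α-ind , α-spans) (u , u∈ , u-ind , u-spans) =
    basis , basis∈ , basis-independent , basis-spans
    where
    uPart : Fin d → V (suc r)
    uPart i = atTail (u i)
    αPart : Fin s → V (suc r)
    αPart l = atHead (α l zero)
    basis = uPart ++ αPart

    basis∈ : ∀ k → Lift A U (basis k)
    basis∈ = ++-all (Lift A U) uPart αPart
      (λ i → IsSubspace.0∈ A-sub , u∈ i)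
      (λ l → IsSubspace.resp A-sub (λ { zero → refl }) (α∈ l) , IsSubspace.0∈ U-sub)

    combination : ∀ c → lincomb c basis ≈ᵥ (lincomb (λ i → c (i ↑ˡ s)) uPart +ᵥ lincomb (λ l → c (d ↑ʳ l)) αPart)
    combination c = ≈ᵥ-trans (lincomb-split d s c basis)
      (+ᵥ-cong (lincomb-cong (λ _ → refl) (λ i → λ k → reflexive (PE.cong (λ z → z k) (lookup-++ˡ uPart αPart i))))
               (lincomb-cong (λ _ → refl) (λ l → λ k → reflexive (PE.cong (λ z → z k) (lookup-++ʳ uPart αPart l)))))

    combination-head : ∀ c → lincomb c basis zero ≈ lincomb (λ l → c (d ↑ʳ l)) α zero
    combination-head c = trans (combination c zero)
      (trans (+-cong (atTail-head _ u) (atHead-head _ α)) (+-identityˡ _))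

    combination-tail : ∀ c j → lincomb c basis (suc j) ≈ lincomb (λ i → c (i ↑ˡ s)) u j
    combination-tail c j = trans (combination c (suc j))
      (trans (+-cong (atTail-tail _ u j) (atHead-tail _ (λ l → α l zero) j)) (+-identityʳ _))

    basis-independent : Independent S basis
    basis-independent c c∈ eq = split-all (λ k → c k ≈ 0#) u-coeffs≈0 α-coeffs≈0
      where
      α-coeffs≈0 : ∀ l → c (d ↑ʳ l) ≈ 0#
      α-coeffs≈0 = α-ind _ (λ l → c∈ _) λ { zero → trans (sym (combination-head c)) (eq zero) }
      u-coeffs≈0 : ∀ i → c (i ↑ˡ s) ≈ 0#
      u-coeffs≈0 = u-ind _ (λ i → c∈ _) (λ j → trans (sym (combination-tail c j)) (eq (suc j)))

    basis-spans : ∀ x → Lift A U x → InSpanOf S basis x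
    basis-spans x (a∈ , u∈′) with α-spans _ a∈ | u-spans _ u∈′
    ... | cα , cα∈ , eqα | cu , cu∈ , equ = cu ++ cα , ++-all S cu cα cu∈ cα∈ , eq
      where
      eq : lincomb (cu ++ cα) basis ≈ᵥ x
      eq zero = trans (combination-head (cu ++ cα))
        (trans (lincomb-cong (λ l → reflexive (lookup-++ʳ cu cα l)) (λ _ → ≈ᵥ-refl) zero) (eqα zero))
      eq (suc j) = trans (combination-tail (cu ++ cα) j)
        (trans (lincomb-cong (λ i → reflexive (lookup-++ˡ cu cα i)) (λ _ → ≈ᵥ-refl) j) (equ j))

  -- If A contains a nonzero a₀, then ⟨Lift A U⟩_F = F e₀ ⊕ (0 × ⟨U⟩_F), so its
  -- F-dimension is one more than that of ⟨U⟩_F.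
  lift-spanDim : ∀ {S r e} {A : V 1 → Set} {U : V r → Set} → IsSubspace S A → IsSubspace S U →
    (a₀ : V 1) → A a₀ → ¬ (a₀ zero ≈ 0#) →
    HasDim AllScalars (SpanOf AllScalars U) e → HasDim AllScalars (SpanOf AllScalars (Lift A U)) (suc e)
  lift-spanDim {r = r} {e} {A} {U} A-sub U-sub a₀ a₀∈ a₀≉0 (b , b∈ , b-ind , b-spans) =
    basis , basis∈ , basis-independent , basis-spans
    where
    basis : Fin (suc e) → V (suc r)
    basis = atHead 1# ∷ (λ i → atTail (b i))

    y = proj₁ (inverse (a₀ zero) a₀≉0)
    a₀y≈1 = proj₂ (inverse (a₀ zero) a₀≉0)

    e₀-combination : lincomb {k = 1} (λ _ → y) (λ _ → atHead (a₀ zero)) ≈ᵥ atHead 1#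
    e₀-combination zero    = trans (+-identityʳ _) (trans (*-comm _ _) a₀y≈1)
    e₀-combination (suc j) = trans (+-identityʳ _) (zeroʳ y)

    basis∈ : ∀ i → SpanOf AllScalars (Lift A U) (basis i)
    basis∈ zero = 1 , (λ _ → atHead (a₀ zero)) ,
      (λ _ → IsSubspace.resp A-sub (λ { zero → refl }) a₀∈ , IsSubspace.0∈ U-sub) ,
      (λ _ → y) , (λ _ → tt) , e₀-combination
    basis∈ (suc i) with b∈ i
    ... | k , v , v∈ , c , _ , eq = k , (λ j → atTail (v j)) , (λ j → IsSubspace.0∈ A-sub , v∈ j) ,
      c , (λ _ → tt) , λ { zero → atTail-head c v ; (suc j) → trans (atTail-tail c v j) (eq j) }

    basis-independent : Independent AllScalars basis
    basis-independent c _ eq zero = begin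
      c zero                                      ≈⟨ sym (*-identityʳ _) ⟩
      c zero * 1#                                 ≈⟨ sym (+-identityʳ _) ⟩
      c zero * 1# + 0#                            ≈⟨ +-congˡ (sym (atTail-head (tail c) b)) ⟩
      lincomb c basis zero                        ≈⟨ eq zero ⟩
      0#                                          ∎
    basis-independent c _ eq (suc i) = b-ind (tail c) (λ _ → tt) tail≈0 i
      where
      tail≈0 : lincomb (tail c) b ≈ᵥ 0ᵥ
      tail≈0 j = begin
        lincomb (tail c) b j                       ≈⟨ sym (atTail-tail (tail c) b j) ⟩
        lincomb (tail c) (λ i → atTail (b i)) (suc j) ≈⟨ sym (+-identityˡ _) ⟩
        0# + lincomb (tail c) (λ i → atTail (b i)) (suc j) ≈⟨ +-congʳ (sym (zeroʳ (c zero))) ⟩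
        lincomb c basis (suc j)                    ≈⟨ eq (suc j) ⟩
        0#                                         ∎

    basis-spans : ∀ x → SpanOf AllScalars (Lift A U) x → InSpanOf AllScalars basis x
    basis-spans x (k , v , v∈ , c , _ , eq) with b-spans (tail x) tail∈
      where
      tail∈ : SpanOf AllScalars U (tail x)
      tail∈ = k , (λ j → tail (v j)) , (λ j → proj₂ (v∈ j)) , c , (λ _ → tt) ,
        λ j → trans (sym (lincomb-tail c v j)) (eq (suc j))
    ... | a , _ , eqa = x zero ∷ a , (λ _ → tt) , combination≈x
      where
      combination≈x : lincomb (x zero ∷ a) basis ≈ᵥ x
      combination≈x zero    = trans (+-cong (*-identityʳ _) (atTail-head a b)) (+-identityʳ _)
      combination≈x (suc j) = trans (+-cong (zeroʳ _) (atTail-tail a b j)) (trans (+-identityˡ _) (eqa j))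

  module HyperplaneBound {K : Carrier → Set} (K-subfield : IsSubfield K)
    (K-enum : Enumeration K) (F-enum : Enumeration AllScalars)
    {r′ d k s : ℕ} {U : V (suc r′) → Set} (U-sub : IsSubspace K U) (U-dim : HasDim K U d)
    (U-evasive : ∀ (W₁ : V (suc r′) → Set) → IsSubspace AllScalars W₁ → HasDim AllScalars W₁ r′ →
                 ∃ λ e → e ℕ.≤ k × HasDim K (λ x → U x × W₁ x) e)
    {β : Fin s → V 1} (β-ind : Independent K β) (d≤k+s : d ℕ.≤ k ℕ.+ s)
    {W : V (suc (suc r′)) → Set} (W-sub : IsSubspace AllScalars W) (W-dim : HasDim AllScalars W (suc r′))
    where
    open OverSubfield K-subfield
    private
      module KF = OverFiniteSubfield K-subfield K-enum
      module FF = OverFiniteSubfield allScalars-subfield F-enum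
      w = proj₁ W-dim
      w-ind = proj₁ (proj₂ (proj₂ W-dim))
      w-spans = proj₂ (proj₂ (proj₂ W-dim))

    A : V 1 → Set
    A = InSpanOf K β

    X : V (suc (suc r′)) → Set
    X x = Lift A U x × W x

    lift-sub : IsSubspace K (Lift A U)
    lift-sub = lift-isSubspace (span-isSubspace β) U-sub

    lift-hasDim : HasDim K (Lift A U) (d ℕ.+ s)
    lift-hasDim = lift-dim (span-isSubspace β) U-sub (span-hasDim β β-ind) U-dim

    X-sub : IsSubspace K X
    X-sub = record
      { resp     = λ x≈y (l , w∈) → L.resp x≈y l , W.resp x≈y w∈
      ; 0∈       = L.0∈ , W.0∈
      ; +-closed = λ {x} {y} (l , w∈) (l′ , w∈′) → L.+-closed {x} {y} l l′ , W.+-closed {x} {y} w∈ w∈′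
      ; ·-closed = λ {a} {x} a∈ (l , w∈) → L.·-closed {a} {x} a∈ l , W.·-closed {a} {x} tt w∈ }
      where
      module L = IsSubspace lift-sub
      module W = IsSubspace W-sub

    HeadZero : V (suc (suc r′)) → Set
    HeadZero x = x zero ≈ 0#

    headZero-sub : IsSubspace K HeadZero
    headZero-sub = record
      { resp = λ x≈y x₀≈0 → trans (sym (x≈y zero)) x₀≈0 ; 0∈ = refl
      ; +-closed = λ x₀≈0 y₀≈0 → trans (+-cong x₀≈0 y₀≈0) (+-identityʳ 0#)
      ; ·-closed = λ _ x₀≈0 → trans (*-congˡ x₀≈0) (zeroʳ _) }

    lift-decomposition : ∀ x → Lift A U x → Decomposition HeadZero (λ l → atHead (β l zero)) x
    lift-decomposition x ((c , c∈ , eq) , _) = record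
      { rest = atTail (tail x) ; coeffs = c ; rest∈ = refl ; coeffs∈ = c∈
      ; splits = λ { zero    → sym (trans (+-identityˡ _) (trans (atHead-head c β) (eq zero)))
                   ; (suc j) → sym (trans (+-congˡ (atHead-tail c (λ l → β l zero) j)) (+-identityʳ _)) } }

    -- W inside the hyperplane: independent families in X embed into U
    inside-bound : (∀ i → w i zero ≈ 0#) → ∀ {a} (f : Fin a → V (suc (suc r′))) →
      Independent K f → (∀ i → X (f i)) → a ℕ.≤ k ℕ.+ s
    inside-bound w-headZero f f-ind f∈ = ℕP.≤-trans
      (steinitz (λ i → tail (f i)) (proj₁ U-dim) (tails-independent f f-headZero f-ind)
                (λ i → proj₂ (proj₂ (proj₂ U-dim)) _ (proj₂ (proj₁ (f∈ i)))))
      d≤k+s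
      where
      f-headZero : ∀ i → f i zero ≈ 0#
      f-headZero i with w-spans (f i) (proj₂ (f∈ i))
      ... | c , _ , eq = trans (sym (eq zero)) (lincomb-headZero c w w-headZero)

    -- W transversal to the hyperplane: the head-zero part of X lies in
    -- 0 × (U ∩ W₁) with dim_F W₁ = r′, and the exchange bound adds s
    transversal-bound : ∀ i₀ → ¬ (w i₀ zero ≈ 0#) → ∀ {a} (f : Fin a → V (suc (suc r′))) →
      Independent K f → (∀ i → X (f i)) → a ℕ.≤ k ℕ.+ s
    transversal-bound i₀ t≉0 f f-ind f∈ =
      ExchangeBound.exchange-bound X-sub headZero-sub k headZero-bound s (λ l → atHead (β l zero))
        f f-ind f∈ (λ i → lift-decomposition (f i) (proj₁ (f∈ i)))
      where
      open HyperplaneSection w w-ind i₀ t≉0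
      U∩W₁ = U-evasive (InSpanOf AllScalars section) (OverF.span-isSubspace section)
                       (OverF.span-hasDim section section-independent)
      headZero-bound : ∀ {a} (v : Fin a → V (suc (suc r′))) → Independent K v →
        (∀ i → X (v i)) → (∀ i → HeadZero (v i)) → a ℕ.≤ k
      headZero-bound v v-ind v∈ v-headZero = ℕP.≤-trans
        (steinitz (λ i → tail (v i)) (proj₁ (proj₂ (proj₂ U∩W₁)))
          (tails-independent v v-headZero v-ind)
          (λ i → proj₂ (proj₂ (proj₂ (proj₂ (proj₂ U∩W₁)))) _
                   (proj₂ (proj₁ (v∈ i)) , section-spans (v i) (w-spans (v i) (proj₂ (v∈ i))) (v-headZero i))))
        (proj₁ (proj₂ U∩W₁))

    independent-bound : ∀ {a} (f : Fin a → V (suc (suc r′))) → Independent K f → (∀ i → X (f i)) → a ℕ.≤ k ℕ.+ s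
    independent-bound with FinP.any? (λ i → ¬? (w i zero ≟ 0#))
    ... | yes (i₀ , t≉0) = transversal-bound i₀ t≉0
    ... | no no-pivot = inside-bound (λ i → decidable-stable (_ ≟ 0#) (λ t≉0 → no-pivot (i , t≉0)))

    -- X is decidable and lies in the span of the basis of Lift A U, so it has a K-basis
    intersection-dim : ∃ λ e → e ℕ.≤ k ℕ.+ s × HasDim K X e
    intersection-dim with KF.GreedyBasis.basis (proj₁ lift-hasDim) (IsSubspace.resp X-sub)
                            (λ x → KF.decMember lift-sub lift-hasDim x ×-dec FF.decMember W-sub W-dim x)
                            (λ x x∈ → proj₂ (proj₂ (proj₂ lift-hasDim)) x (proj₁ x∈))
    ... | e , f , f∈ , f-ind , f-spans = e , independent-bound f f-ind f∈ , f , f∈ , f-ind , f-spans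

-- The ℕ operators of the statement are imported only here, since they would
-- clash with the ring operators opened in the modules above.
open import Data.Nat using (_≤_; _+_; _∸_)

-- Take s K-independent elements β of F from a K-basis of F and A = ⟨β⟩_K;
-- Lift A U is the required subspace.

proposition2p8 : (F : CommutativeRing 0ℓ 0ℓ) → LinAlg.IsField F →
    (K : CommutativeRing.Carrier F → Set) → LinAlg.IsSubfield F K →
    (q n : ℕ) → LinAlg.HasOrder F K q → LinAlg.ExtensionDegree F K n →
    (r k d : ℕ) → 1 ≤ r ∸ 1 → 1 ≤ k →
    (U : LinAlg.V F r → Set) → LinAlg.IsSubspace F K U → LinAlg.HasDim F K U d →
    LinAlg.IsEvasive F K (r ∸ 1) k U →
    (s : ℕ) → 1 ≤ s → d ≤ k + s → s ≤ n →
    Σ (LinAlg.V F (suc r) → Set) λ U′ →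
      LinAlg.IsSubspace F K U′ × LinAlg.HasDim F K U′ (d + s)
      × LinAlg.IsEvasive F K r (k + s) U′
proposition2p8 _ _ _ _ _ _ _ _ zero _ _ () _ _ _ _ _ _ _ _ _
proposition2p8 _ _ _ _ _ _ _ _ (suc r′) _ _ _ _ _ _ _ _ zero () _ _
proposition2p8 F isF K sfK _ _ hoK ext (suc r′) k d _ _ U sU hdU (U-spanDim , U-evasive) (suc s′) _ d≤k+s s≤n =
  Lift A U , lift-isSubspace A-sub sU , lift-dim A-sub sU (span-hasDim β β-ind) hdU ,
  (suc (proj₁ U-spanDim) , s≤s (proj₁ (proj₂ U-spanDim)) ,
   lift-spanDim A-sub sU (β zero) (member∈span β zero) β₀≉0 (proj₂ (proj₂ U-spanDim))) ,
  λ W W-sub W-dim → HyperplaneBound.intersection-dim sfK K-enum F-enum sU hdU U-evasive {β = β} β-ind d≤k+s W-sub W-dim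
  where
  open LinAlg F
  open LinearAlgebra F isF
  open OverSubfield sfK
  open Lifting F isF
  β-family : Σ (Fin (suc s′) → V 1) (Independent K)
  β-family = independent-subfamily (proj₁ ext) (proj₁ (proj₂ (proj₂ ext))) s≤n
  β : Fin (suc s′) → V 1
  β = proj₁ β-family
  β-ind : Independent K β
  β-ind = proj₂ β-family
  A : V 1 → Set
  A = InSpanOf K β
  A-sub : IsSubspace K A
  A-sub = span-isSubspace β
  -- β₀ is a nonzero element of A, which makes ⟨Lift A U⟩_F one dimension larger
  β₀≉0 : ¬ (CommutativeRing._≈_ F (β zero zero) (CommutativeRing.0# F))
  β₀≉0 β₀≈0 = independent-nonzero β β-ind zero (λ { zero → β₀≈0 })
  K-enum : Enumeration K
  K-enum = enumeration-of-order hoK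
  F-enum : Enumeration AllScalars
  F-enum = enumeration-of-extension K-enum ext
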